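{- Let $r_1,r_2\in\mathbb{Z}^+$, let $G_1$ be a finite $3r_1$-regular graph and $G_2$ a finite $2r_2$-regular graph. Suppose $G_1$ is 3-balanced and $G_2$ is 2-balanced. Then the tensor product $G_1\times G_2$ is 3-balanced.
   Context: A graph is 3-balanced if it admits a vertex coloring $\ell:V\to\mathbb{Z}_3$ such that every vertex has, in its open neighborhood, the same number of vertices of each of the three colors. A graph is 2-balanced if it admits a vertex coloring with two colors such that every vertex has, in its open neighborhood, the same number of vertices of each of the two colors. The tensor product $G_1\times G_2$ has vertex set $V(G_1)\times V(G_2)$ with $(u,v)\sim(u',v')$ iff $uu'\in E(G_1)$ and $vv'\in E(G_2)$. -}

module Defs where

open import Data.Nat using (ℕ; zero; suc; _+_; _*_)
open import Data.Fin using (Fin; zero; suc; remQuot; _≟_)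
open import Data.Bool using (Bool; true; false; _∧_; if_then_else_)
open import Data.Product using (Σ; ∃; _,_; proj₁; proj₂)
open import Relation.Binary.PropositionalEquality using (_≡_)
open import Relation.Nullary.Decidable using (⌊_⌋)

record Graph (n : ℕ) : Set where
  field
    adj    : Fin n → Fin n → Bool
    sym    : ∀ u v → adj u v ≡ adj v u
    irrefl : ∀ v → adj v v ≡ false
open Graph public

count : ∀ {n} → (Fin n → Bool) → ℕ
count {zero}  p = 0
count {suc n} p = (if p zero then 1 else 0) + count {n} (λ i → p (suc i))

degree : ∀ {n} → Graph n → Fin n → ℕ
degree G v = count (adj G v)

Regular : ∀ {n} → Graph n → ℕ → Set
Regular G k = ∀ v → degree G v ≡ k

colourCount : ∀ {n m} → Graph n → (Fin n → Fin m) → Fin n → Fin m → ℕ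
colourCount G ℓ v c = count (λ u → adj G v u ∧ ⌊ ℓ u ≟ c ⌋)

Balanced : ∀ {n} → ℕ → Graph n → Set
Balanced {n} m G =
  Σ (Fin n → Fin m) λ ℓ → ∀ v (c c′ : Fin m) → colourCount G ℓ v c ≡ colourCount G ℓ v c′

-- tensor product; vertex set Fin (n₁ * n₂) ≅ Fin n₁ × Fin n₂ via remQuot
tensorAdj : ∀ {n₁ n₂} → Graph n₁ → Graph n₂ → Fin (n₁ * n₂) → Fin (n₁ * n₂) → Bool
tensorAdj {n₁} {n₂} G₁ G₂ x y =
  adj G₁ (proj₁ (remQuot {n₁} n₂ x)) (proj₁ (remQuot {n₁} n₂ y)) ∧
  adj G₂ (proj₂ (remQuot {n₁} n₂ x)) (proj₂ (remQuot {n₁} n₂ y))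

open import Data.Bool.Properties using (∧-comm)
open import Relation.Binary.PropositionalEquality using (cong₂; cong; trans)

_⊗_ : ∀ {n₁ n₂} → Graph n₁ → Graph n₂ → Graph (n₁ * n₂)
_⊗_ {n₁} {n₂} G₁ G₂ = record
  { adj    = tensorAdj G₁ G₂
  ; sym    = λ x y → cong₂ _∧_ (Graph.sym G₁ _ _) (Graph.sym G₂ _ _)
  ; irrefl = λ x → cong (_∧ _) (Graph.irrefl G₁ _)
  }

{-# OPTIONS --safe #-}
-- Colour a vertex (u , v) of G₁ ⊗ G₂ by the colour of u in a balanced
-- colouring of G₁. The neighbours of (u , v) are the pairs (u′ , v′) with
-- u′ ∼ u and v′ ∼ v, so the number of them with colour c is the number of
-- neighbours of u with colour c times the degree of v, which does not
-- depend on c.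
module Submission where

open import Defs hiding (sym)
open import Data.Nat using (ℕ; zero; suc; _+_; _*_)
open import Data.Nat.Properties using (+-assoc; +-identityʳ; *-distribʳ-+)
open import Data.Fin using (Fin; zero; suc; _↑ˡ_; _↑ʳ_; remQuot; combine; _≟_)
open import Data.Fin.Properties using (remQuot-combine)
open import Data.Bool using (Bool; true; false; _∧_; if_then_else_)
open import Data.Bool.Properties using (∧-commutativeMonoid)
open import Algebra.Bundles using (CommutativeMonoid)
open import Algebra.Properties.CommutativeSemigroup
  (CommutativeMonoid.commutativeSemigroup ∧-commutativeMonoid) using (xy∙z≈xz∙y)
open import Data.Product using (_,_; proj₁; proj₂)
open import Relation.Binary.PropositionalEquality
  using (_≡_; refl; sym; trans; cong; cong₂; module ≡-Reasoning)
open import Relation.Nullary.Decidable using (⌊_⌋)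

count-cong : ∀ {n} {p q : Fin n → Bool} → (∀ i → p i ≡ q i) → count p ≡ count q
count-cong {zero}  p≗q = refl
count-cong {suc n} p≗q =
  cong₂ _+_ (cong (λ b → if b then 1 else 0) (p≗q zero)) (count-cong (λ i → p≗q (suc i)))

count-const-false : ∀ {n} → count {n} (λ _ → false) ≡ 0
count-const-false {zero}  = refl
count-const-false {suc n} = count-const-false {n}

count-+ : ∀ m {n} (p : Fin (m + n) → Bool) →
          count p ≡ count (λ i → p (i ↑ˡ n)) + count (λ j → p (m ↑ʳ j))
count-+ zero    p = refl
count-+ (suc m) p = trans (cong (b +_) (count-+ m (λ i → p (suc i))))
                          (sym (+-assoc b _ _))
  where b = if p zero then 1 else 0

count-∧ˡ : ∀ {n} b (q : Fin n → Bool) → count (λ j → b ∧ q j) ≡ (if b then 1 else 0) * count q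
count-∧ˡ true  q = sym (+-identityʳ (count q))
count-∧ˡ {n} false q = count-const-false {n}

count-combine-∧ : ∀ m {n} (p : Fin m → Bool) (q : Fin n → Bool) (f : Fin (m * n) → Bool) →
                  (∀ i j → f (combine i j) ≡ p i ∧ q j) → count f ≡ count p * count q
count-combine-∧ zero    p q f f∘combine≗p∧q = refl
count-combine-∧ (suc m) {n} p q f f∘combine≗p∧q = begin
  count f
    ≡⟨ count-+ n f ⟩
  count (λ j → f (j ↑ˡ (m * n))) + count (λ y → f (n ↑ʳ y))
    ≡⟨ cong₂ _+_ (count-cong (f∘combine≗p∧q zero))
                 (count-combine-∧ m (λ i → p (suc i)) q (λ y → f (n ↑ʳ y))
                                  (λ i → f∘combine≗p∧q (suc i))) ⟩
  count (λ j → p zero ∧ q j) + count (λ i → p (suc i)) * count q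
    ≡⟨ cong (_+ count (λ i → p (suc i)) * count q) (count-∧ˡ (p zero) q) ⟩
  (if p zero then 1 else 0) * count q + count (λ i → p (suc i)) * count q
    ≡⟨ *-distribʳ-+ (count q) (if p zero then 1 else 0) _ ⟨
  count p * count q
    ∎
  where open ≡-Reasoning

module _ {n₁ n₂ : ℕ} (G₁ : Graph n₁) (G₂ : Graph n₂) where

  liftˡ : ∀ {m} → (Fin n₁ → Fin m) → Fin (n₁ * n₂) → Fin m
  liftˡ ℓ y = ℓ (proj₁ (remQuot {n₁} n₂ y))

  colourCount-⊗-liftˡ : ∀ {m} (ℓ : Fin n₁ → Fin m) x c →
    let (u , v) = remQuot {n₁} n₂ x in
    colourCount (G₁ ⊗ G₂) (liftˡ ℓ) x c ≡ colourCount G₁ ℓ u c * degree G₂ v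
  colourCount-⊗-liftˡ ℓ x c =
    count-combine-∧ n₁ (λ u′ → adj G₁ u u′ ∧ ⌊ ℓ u′ ≟ c ⌋) (adj G₂ v) _ neighbour-of-colour
    where
    u = proj₁ (remQuot {n₁} n₂ x)
    v = proj₂ (remQuot {n₁} n₂ x)
    neighbour-of-colour : ∀ i j →
      (adj G₁ u (proj₁ (remQuot {n₁} n₂ (combine i j))) ∧ adj G₂ v (proj₂ (remQuot {n₁} n₂ (combine i j))))
        ∧ ⌊ ℓ (proj₁ (remQuot {n₁} n₂ (combine i j))) ≟ c ⌋
      ≡ (adj G₁ u i ∧ ⌊ ℓ i ≟ c ⌋) ∧ adj G₂ v j
    neighbour-of-colour i j =
      trans (cong (λ (i′ , j′) → (adj G₁ u i′ ∧ adj G₂ v j′) ∧ ⌊ ℓ i′ ≟ c ⌋) (remQuot-combine i j))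
            (xy∙z≈xz∙y (adj G₁ u i) (adj G₂ v j) ⌊ ℓ i ≟ c ⌋)

  Balanced-⊗ˡ : ∀ {m} → Balanced m G₁ → Balanced m (G₁ ⊗ G₂)
  Balanced-⊗ˡ (ℓ , balanced) = liftˡ ℓ , λ x c c′ →
    let (u , v) = remQuot {n₁} n₂ x in begin
    colourCount (G₁ ⊗ G₂) (liftˡ ℓ) x c  ≡⟨ colourCount-⊗-liftˡ ℓ x c ⟩
    colourCount G₁ ℓ u c * degree G₂ v   ≡⟨ cong (_* degree G₂ v) (balanced u c c′) ⟩
    colourCount G₁ ℓ u c′ * degree G₂ v  ≡⟨ colourCount-⊗-liftˡ ℓ x c′ ⟨
    colourCount (G₁ ⊗ G₂) (liftˡ ℓ) x c′ ∎
    where open ≡-Reasoning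

theorem6p8 : ∀ (r₁ r₂ : ℕ) {n₁ n₂ : ℕ} (G₁ : Graph n₁) (G₂ : Graph n₂) →
    Regular G₁ (3 * suc r₁) → Regular G₂ (2 * suc r₂) →
    Balanced 3 G₁ → Balanced 2 G₂ → Balanced 3 (G₁ ⊗ G₂)
theorem6p8 r₁ r₂ G₁ G₂ _ _ balanced₁ _ = Balanced-⊗ˡ G₁ G₂ balanced₁
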